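{- Let $n\geq 4$ be an integer and let $P=\{C_i : 1\leq i\leq n\}$, where $C_i=\{[i,ij] : j\in[n],\ j\neq i\}$, be the clique partition of the vertex set of $L(n)$. Let $C\in P$ and let $v,w$ be two distinct vertices in $C$. Let $t$ be an integer with $2\leq t\leq n-1$. Then there exist a $t$-element subset $\{A_1,\dots,A_t\}\subseteq P\setminus\{C\}$ and a $v$-$w$ path $Q: v,v_1,w_1,v_2,w_2,\dots,v_t,w_t,w$ of length $2t+1$ in $L(n)$ such that $v_i,w_i\in A_i$ for each $1\leq i\leq t$.
   Context: Let $n\geq 3$ and $[n]=\{1,2,\dots,n\}$. The graph $B(n)$ has vertex set $\{v : v\subset [n],\ |v|\in\{1,2\}\}$, and two vertices $v,w$ are adjacent iff $v\subset w$ or $w\subset v$. The graph $L(n)$ is the line graph of $B(n)$. Equivalently, the vertices of $L(n)$ are the pairs $[i,ij]:=\{\{i\},\{i,j\}\}$ with $i,j\in[n]$, $i\neq j$, and two distinct vertices $[i,ij]$ and $[r,rs]$ are adjacent iff $i=r$ or $\{i,j\}=\{r,s\}$. Each $C_i$ induces a clique of order $n-1$, and the $C_i$ partition the vertex set. A path means a sequence of pairwise distinct vertices with consecutive ones adjacent; its length is the number of edges. -}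

module Defs where

open import Data.Nat using (ℕ)
open import Data.Fin using (Fin)
open import Data.Product using (_×_; _,_; proj₁; proj₂)
open import Data.Sum using (_⊎_)
open import Data.List using (List; []; _∷_; _++_; concatMap; map)
open import Data.List.Relation.Unary.All using (All)
open import Data.List.Relation.Unary.Unique.Propositional using (Unique)
open import Data.List.Relation.Unary.Linked using (Linked)
open import Data.List.Relation.Unary.AllPairs using ()
open import Relation.Binary.PropositionalEquality using (_≡_; _≢_)

-- A candidate vertex [i,ij] of L(n) is encoded as the ordered pair (i , j).
Pt : ℕ → Set
Pt n = Fin n × Fin n

IsVertex : ∀ {n} → Pt n → Set
IsVertex (i , j) = i ≢ j

-- [i,ij] ~ [r,rs]  iff  i = r  or  {i,j} = {r,s}  (distinctness imposed separately)
Adj : ∀ {n} → Pt n → Pt n → Set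
Adj (i , j) (r , s) = (i ≡ r) ⊎ ((i ≡ r × j ≡ s) ⊎ (i ≡ s × j ≡ r))

InClique : ∀ {n} → Pt n → Fin n → Set
InClique (i , j) c = i ≡ c

-- A path: a list of vertices of L(n), pairwise distinct, consecutive ones adjacent.
-- Its length (number of edges) is (length of list − 1).
IsPath : ∀ {n} → List (Pt n) → Set
IsPath xs = All IsVertex xs × Unique xs × Linked Adj xs

pathSeq : ∀ {n} → Pt n → List (Pt n × Pt n) → Pt n → List (Pt n)
pathSeq v ps w = v ∷ (concatMap (λ p → proj₁ p ∷ proj₂ p ∷ []) ps ++ (w ∷ []))

{-# OPTIONS --safe #-}
-- Walk through the cliques of distinct hubs a = x₁, x₂, …, x_t = b, all different from c,
-- visiting the clique of xₖ through the vertices [xₖ, xₖx_{k−1}] and [xₖ, xₖx_{k+1}]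
-- (with x₀ = x_{t+1} = c).  Consecutive crossings are joined by the edge
-- [xₖ, xₖx_{k+1}] ~ [x_{k+1}, x_{k+1}xₖ], and the path is closed off by v = [c, ca] and
-- w = [c, cb].  Its vertices are distinct because vertices in different cliques are, and
-- inside the clique of xₖ the two neighbours x_{k−1} ≠ x_{k+1} differ since t ≥ 2.
-- The t − 2 inner hubs are an injective image of Fin (t − 2) avoiding c, a and b.
module Submission where

open import Defs
open import Data.Nat using (ℕ; _≤_; _∸_; _+_; suc; s≤s; z≤n)
open import Data.Nat.Properties using (+-comm)
open import Data.Fin using (Fin; zero; suc; punchIn; punchOut; inject≤)
open import Data.Fin.Properties
  using (punchIn-injective; punchInᵢ≢i; punchIn-punchOut; punchOut-injective; inject≤-injective)
open import Data.Product using (Σ; _×_; _,_; proj₁; proj₂)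
open import Data.Sum using (inj₁; inj₂)
open import Data.List using (List; []; _∷_; _++_; map; concatMap; tabulate; lookup; length)
open import Data.List.Properties using (length-map; length-++; length-tabulate; tabulate-lookup)
open import Data.List.Membership.Propositional.Properties using (∈-lookup)
open import Data.List.Relation.Unary.All as All using (All; []; _∷_)
import Data.List.Relation.Unary.All.Properties as All
open import Data.List.Relation.Unary.AllPairs as AllPairs using (AllPairs; []; _∷_)
import Data.List.Relation.Unary.AllPairs.Properties as AllPairs
open import Data.List.Relation.Unary.Unique.Propositional using (Unique)
import Data.List.Relation.Unary.Unique.Propositional.Properties as Unique
open import Data.List.Relation.Unary.Linked using (Linked; [-]; _∷_)
open import Function using (_∘_; _on_)
open import Function.Definitions using (Injective)
open import Relation.Nullary using (contradiction)
open import Relation.Binary.PropositionalEquality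
  using (_≡_; _≢_; refl; sym; trans; cong; subst; ≢-sym)

lookup-injective : {A B : Set} {f : A → B} (xs : List A) →
                   AllPairs (_≢_ on f) xs → Injective _≡_ _≡_ (f ∘ lookup xs)
lookup-injective (x ∷ xs) _          {zero}  {zero}  _  = refl
lookup-injective (x ∷ xs) (x∉xs ∷ _) {zero}  {suc j} eq =
  contradiction eq (All.lookup x∉xs (∈-lookup j))
lookup-injective (x ∷ xs) (x∉xs ∷ _) {suc i} {zero}  eq =
  contradiction (sym eq) (All.lookup x∉xs (∈-lookup i))
lookup-injective (x ∷ xs) (_ ∷ xs!)  {suc i} {suc j} eq = cong suc (lookup-injective xs xs! eq)

punchIn-avoids : ∀ {k} {x y : Fin (suc k)} {j : Fin k} (x≢y : x ≢ y) →
                 j ≢ punchOut x≢y → punchIn x j ≢ y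
punchIn-avoids {x = x} x≢y j≢y′ eq =
  j≢y′ (punchIn-injective x _ _ (trans eq (sym (punchIn-punchOut x≢y))))

injection-avoiding₃ : ∀ {m n} → 3 + m ≤ n → {c a b : Fin n} → c ≢ a → c ≢ b → a ≢ b →
  Σ (Fin m → Fin n) λ f → Injective _≡_ _≡_ f × (∀ i → c ≢ f i × a ≢ f i × b ≢ f i)
injection-avoiding₃ {m} {suc (suc (suc k))} (s≤s (s≤s (s≤s m≤k))) {c} {a} {b} c≢a c≢b a≢b =
  f , f-injective , λ i → ≢-sym (c-avoided i) , ≢-sym (a-avoided i) , ≢-sym (b-avoided i)
  where
  a′≢b′ : punchOut c≢a ≢ punchOut c≢b
  a′≢b′ = a≢b ∘ punchOut-injective c≢a c≢b

  a′ : Fin (2 + k)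
  a′ = punchOut c≢a

  b″ : Fin (1 + k)
  b″ = punchOut a′≢b′

  f : Fin m → Fin (3 + k)
  f i = punchIn c (punchIn a′ (punchIn b″ (inject≤ i m≤k)))

  f-injective : Injective _≡_ _≡_ f
  f-injective {i} {j} =
    inject≤-injective m≤k m≤k i j ∘ punchIn-injective b″ _ _ ∘
    punchIn-injective a′ _ _ ∘ punchIn-injective c _ _

  c-avoided : ∀ i → f i ≢ c
  c-avoided i = punchInᵢ≢i c _
  a-avoided : ∀ i → f i ≢ a
  a-avoided i = punchIn-avoids c≢a (punchInᵢ≢i a′ _)
  b-avoided : ∀ i → f i ≢ b
  b-avoided i = punchIn-avoids c≢b (punchIn-avoids a′≢b′ (punchInᵢ≢i b″ _))

Detour : ∀ {n} → Fin n → Pt n → Pt n → ℕ → Set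
Detour {n} c v w t = Σ (Fin t → Fin n) λ A →
  Injective _≡_ _≡_ A × (∀ k → A k ≢ c) ×
  Σ (Fin t → Pt n) λ vs → Σ (Fin t → Pt n) λ ws →
    (∀ k → InClique (vs k) (A k) × InClique (ws k) (A k)) ×
    IsPath (pathSeq v (tabulate (λ k → vs k , ws k)) w)

module _ {n : ℕ} where

  hub : Pt n × Pt n → Fin n
  hub = proj₁ ∘ proj₁

  flatten : List (Pt n × Pt n) → List (Pt n)
  flatten = concatMap (λ p → proj₁ p ∷ proj₂ p ∷ [])

  Crossing : Pt n × Pt n → Set
  Crossing (u , u′) = proj₁ u′ ≡ proj₁ u × IsVertex u × IsVertex u′ × proj₂ u ≢ proj₂ u′

  crossings : Fin n → List (Fin n) → Fin n → List (Pt n × Pt n)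
  crossings p []      q = []
  crossings p (x ∷ r) q = ((x , p) , (x , next r)) ∷ crossings x r q
    where
    next : List (Fin n) → Fin n
    next []      = q
    next (y ∷ _) = y

  map-hub-crossings : ∀ p L q → map hub (crossings p L q) ≡ L
  map-hub-crossings p []      q = refl
  map-hub-crossings p (x ∷ r) q = cong (x ∷_) (map-hub-crossings x r q)

  crossings-crossing : ∀ {p x b q : Fin n} M →
                       Unique (p ∷ x ∷ M ++ b ∷ []) → All (q ≢_) (x ∷ M ++ b ∷ []) →
                       All Crossing (crossings p (x ∷ M ++ b ∷ []) q)
  crossings-crossing [] ((p≢x ∷ p≢b ∷ []) ∷ (x≢b ∷ []) ∷ _) (q≢x ∷ q≢b ∷ []) =
    (refl , ≢-sym p≢x , x≢b , p≢b) ∷ (refl , ≢-sym x≢b , ≢-sym q≢b , ≢-sym q≢x) ∷ []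
  crossings-crossing (y ∷ M) ((p≢x ∷ p≢y ∷ _) ∷ x∷M!@((x≢y ∷ _) ∷ _)) (_ ∷ q∉) =
    (refl , ≢-sym p≢x , x≢y , p≢y) ∷ crossings-crossing M x∷M! q∉

  swap-adjacent : ∀ {i j : Fin n} → Adj (i , j) (j , i)
  swap-adjacent = inj₂ (inj₂ (refl , refl))

  same-clique-adjacent : ∀ {i j k : Fin n} → Adj (i , j) (i , k)
  same-clique-adjacent = inj₁ refl

  crossings-linked : ∀ p x M b q →
    Linked Adj ((p , x) ∷ flatten (crossings p (x ∷ M ++ b ∷ []) q) ++ (q , b) ∷ [])
  crossings-linked p x []      b q =
    swap-adjacent ∷ same-clique-adjacent ∷ swap-adjacent ∷ same-clique-adjacent ∷ swap-adjacent ∷ [-]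
  crossings-linked p x (y ∷ M) b q =
    swap-adjacent ∷ same-clique-adjacent ∷ crossings-linked x y M b q

  flatten-all : ∀ {P : Pt n → Set} {V} →
                All (λ e → P (proj₁ e) × P (proj₂ e)) V → All P (flatten V)
  flatten-all []                = []
  flatten-all ((p₁ , p₂) ∷ ps) = p₁ ∷ p₂ ∷ flatten-all ps

  flatten-first : ∀ {P : Fin n → Set} {V} →
                  All Crossing V → All (P ∘ hub) V → All (P ∘ proj₁) (flatten V)
  flatten-first {P} crossing ps =
    flatten-all (All.zipWith (λ ((same , _) , p) → p , subst P (sym same) p) (crossing , ps))

  flatten-unique : ∀ {V} → AllPairs (_≢_ on hub) V → All Crossing V → Unique (flatten V)
  flatten-unique [] [] = []
  flatten-unique {(u , u′) ∷ V} (u∉V ∷ V!) ((same , _ , _ , turn) ∷ crossing) =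
    (turn ∘ cong proj₂ ∷ All.map (λ ne → ne ∘ cong proj₁) away) ∷
    All.map (λ ne → ne ∘ trans (sym same) ∘ cong proj₁) away ∷
    flatten-unique V! crossing
    where
    away : All ((proj₁ u ≢_) ∘ proj₁) (flatten V)
    away = flatten-first crossing u∉V

  detour-unique : ∀ {u w V} → u ≢ w → All ((proj₁ u ≢_) ∘ hub) V → All ((proj₁ w ≢_) ∘ hub) V →
                  AllPairs (_≢_ on hub) V → All Crossing V → Unique (u ∷ flatten V ++ w ∷ [])
  detour-unique u≢w u∉V w∉V V! crossing =
    All.++⁺ (All.map (λ ne → ne ∘ cong proj₁) (flatten-first crossing u∉V)) (u≢w ∷ []) ∷
    AllPairs.++⁺ (flatten-unique V! crossing) ([] ∷ [])
      (All.map (λ ne → (λ eq → ne (cong proj₁ (sym eq))) ∷ []) (flatten-first crossing w∉V))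

  crossings-detour : ∀ {c : Fin n} {v w} V →
                     All ((c ≢_) ∘ hub) V → AllPairs (_≢_ on hub) V → All Crossing V →
                     IsPath (pathSeq v V w) → Detour c v w (length V)
  crossings-detour {v = v} {w} V c∉V V! crossing path =
    hub ∘ lookup V , lookup-injective {f = hub} V V! ,
    (λ k → ≢-sym (All.lookup c∉V (∈-lookup k))) ,
    proj₁ ∘ lookup V , proj₂ ∘ lookup V ,
    (λ k → refl , proj₁ (All.lookup crossing (∈-lookup k))) ,
    subst (λ ps → IsPath (pathSeq v ps w)) (sym (tabulate-lookup V)) path

  detour-through : ∀ {c a b : Fin n} M → Unique (c ∷ a ∷ M ++ b ∷ []) →
                   Detour c (c , a) (c , b) (2 + length M)
  detour-through {c} {a} {b} M c∷L!@(c∉L@(c≢a ∷ c∉M++b) ∷ L!@(a∉M++b ∷ _)) =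
    subst (Detour c (c , a) (c , b)) length-V (crossings-detour V c∉V V! crossing path)
    where
    L : List (Fin n)
    L = a ∷ M ++ b ∷ []

    V : List (Pt n × Pt n)
    V = crossings c L c

    hubs : map hub V ≡ L
    hubs = map-hub-crossings c L c

    c∉V : All ((c ≢_) ∘ hub) V
    c∉V = All.map⁻ (subst (All (c ≢_)) (sym hubs) c∉L)

    V! : AllPairs (_≢_ on hub) V
    V! = AllPairs.map⁻ (subst Unique (sym hubs) L!)

    crossing : All Crossing V
    crossing = crossings-crossing M c∷L! c∉L

    c≢b : c ≢ b
    c≢b = proj₂ (All.∷ʳ⁻ c∉M++b)

    v≢w : (c , a) ≢ (c , b)
    v≢w = proj₂ (All.∷ʳ⁻ a∉M++b) ∘ cong proj₂

    path : IsPath (pathSeq (c , a) V (c , b))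
    path = c≢a ∷ All.++⁺ (flatten-all (All.map (λ (_ , x , x′ , _) → x , x′) crossing)) (c≢b ∷ []) ,
           detour-unique v≢w c∉V c∉V V! crossing ,
           crossings-linked c a M b c

    length-V : length V ≡ 2 + length M
    length-V = trans (sym (length-map hub V))
      (trans (cong length hubs) (cong suc (trans (length-++ M) (+-comm (length M) 1))))

distinct-hubs : ∀ {m n} → 3 + m ≤ n → {c a b : Fin n} → c ≢ a → c ≢ b → a ≢ b →
  Σ (List (Fin n)) λ M → length M ≡ m × Unique (c ∷ a ∷ M ++ b ∷ [])
distinct-hubs 3+m≤n {c} {a} {b} c≢a c≢b a≢b
  with f , f-injective , f-avoids ← injection-avoiding₃ 3+m≤n c≢a c≢b a≢b =
  tabulate f , length-tabulate f ,
  (c≢a ∷ All.++⁺ (All.tabulate⁺ (proj₁ ∘ f-avoids)) (c≢b ∷ [])) ∷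
  All.++⁺ (All.tabulate⁺ (proj₁ ∘ proj₂ ∘ f-avoids)) (a≢b ∷ []) ∷
  AllPairs.++⁺ (Unique.tabulate⁺ f-injective) ([] ∷ [])
    (All.tabulate⁺ (λ i → ≢-sym (proj₂ (proj₂ (f-avoids i))) ∷ []))

lemma2p2 : (n : ℕ) → 4 ≤ n → (c : Fin n) → (v w : Pt n) →
    IsVertex v → IsVertex w → InClique v c → InClique w c → v ≢ w →
    (t : ℕ) → 2 ≤ t → t ≤ n ∸ 1 →
    Σ (Fin t → Fin n) λ A →
    Injective _≡_ _≡_ A × (∀ k → A k ≢ c) ×
    Σ (Fin t → Pt n) λ vs → Σ (Fin t → Pt n) λ ws →
    (∀ k → InClique (vs k) (A k) × InClique (ws k) (A k)) ×
    IsPath (pathSeq v (tabulate (λ k → vs k , ws k)) w)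
lemma2p2 (suc n) _ c (.c , a) (.c , b) c≢a c≢b refl refl v≢w (suc (suc m)) (s≤s (s≤s z≤n)) t≤n
  with M , |M|≡m , c∷L! ← distinct-hubs (s≤s t≤n) c≢a c≢b (v≢w ∘ cong (c ,_)) =
  subst (Detour c (c , a) (c , b)) (cong (2 +_) |M|≡m) (detour-through M c∷L!)
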